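{- Let $s\ge 2$ be an integer. If $H$ is any graph of order $t$ without isolated vertices, then $r_{pot}(K_s,H)\ge t+s-2$. In particular, for any tree $T_t$ of order $t$, $r_{pot}(K_s,T_t)\ge t+s-2$.
   Context: All graphs are finite and simple. A sequence of nonnegative integers $\pi=(d_1,\dots,d_n)$ (always taken nonincreasing) is graphic if some graph of order $n$ has degree sequence $\pi$; such a graph is a realization of $\pi$. For a graph $H$, a graphic sequence $\pi$ is potentially $H$-graphic if some realization of $\pi$ contains $H$ as a subgraph. For an $N$-term sequence $\pi=(d_1,\dots,d_N)$, the complementary sequence is $\overline{\pi}=(N-1-d_N,\dots,N-1-d_1)$. For graphs $H_1,H_2$, the potential-Ramsey number $r_{pot}(H_1,H_2)$ is the minimum integer $N$ such that for every $N$-term graphic sequence $\pi$, either $\pi$ is potentially $H_1$-graphic or $\overline{\pi}$ is potentially $H_2$-graphic. $K_s$ is the complete graph on $s$ vertices. -}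

module Defs where

open import Data.Nat using (ℕ; zero; suc; _+_; _∸_; _≤_; _<_)
open import Data.Bool using (Bool; true; false; if_then_else_; not)
open import Data.Fin using (Fin; zero; suc; opposite; _<_)
open import Data.Fin.Properties using (_≟_)
open import Data.Vec using (Vec; lookup; tabulate)
open import Data.Product using (Σ; ∃; ∃-syntax; _×_; _,_)
open import Data.Sum using (_⊎_)
open import Relation.Binary.PropositionalEquality using (_≡_)
open import Relation.Nullary using (¬_)
open import Relation.Nullary.Decidable using (⌊_⌋)
open import Function.Definitions using (Injective)

record Graph (n : ℕ) : Set where
  field
    adj   : Fin n → Fin n → Bool
    sym   : ∀ u v → adj u v ≡ adj v u
    irrefl : ∀ v → adj v v ≡ false
open Graph public

count : ∀ {n} → (Fin n → Bool) → ℕ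
count {zero}  f = 0
count {suc n} f = (if f zero then 1 else 0) + count (λ i → f (suc i))

degree : ∀ {n} → Graph n → Fin n → ℕ
degree G u = count (adj G u)

NoIsolated : ∀ {t} → Graph t → Set
NoIsolated H = ∀ v → ∃[ u ] adj H v u ≡ true

_⊆G_ : ∀ {t n} → Graph t → Graph n → Set
_⊆G_ {t} {n} H G = Σ (Fin t → Fin n) λ f →
  Injective _≡_ _≡_ f × (∀ u v → adj H u v ≡ true → adj G (f u) (f v) ≡ true)

K : (s : ℕ) → Graph s
K s = record
  { adj = λ u v → not ⌊ u ≟ v ⌋
  ; sym = symK
  ; irrefl = irrK }
  where
  symK : ∀ u v → not ⌊ u ≟ v ⌋ ≡ not ⌊ v ≟ u ⌋
  symK u v with u ≟ v | v ≟ u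
  ... | Relation.Nullary.yes _ | Relation.Nullary.yes _ = Relation.Binary.PropositionalEquality.refl
  ... | Relation.Nullary.no _  | Relation.Nullary.no _  = Relation.Binary.PropositionalEquality.refl
  ... | Relation.Nullary.yes p | Relation.Nullary.no q  = Data.Empty.⊥-elim (q (Relation.Binary.PropositionalEquality.sym p))
    where import Data.Empty
  ... | Relation.Nullary.no q  | Relation.Nullary.yes p = Data.Empty.⊥-elim (q (Relation.Binary.PropositionalEquality.sym p))
    where import Data.Empty
  irrK : ∀ v → not ⌊ v ≟ v ⌋ ≡ false
  irrK v with v ≟ v
  ... | Relation.Nullary.yes _ = Relation.Binary.PropositionalEquality.refl
  ... | Relation.Nullary.no q  = Data.Empty.⊥-elim (q Relation.Binary.PropositionalEquality.refl)
    where import Data.Empty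

Nonincreasing : ∀ {N} → Vec ℕ N → Set
Nonincreasing {N} π = ∀ (i j : Fin N) → i Data.Fin.< j → lookup π j ≤ lookup π i

-- G is a realization of π (vertex i has degree d_{i+1})
Realizes : ∀ {N} → Graph N → Vec ℕ N → Set
Realizes {N} G π = ∀ i → degree G i ≡ lookup π i

Graphic : ∀ {N} → Vec ℕ N → Set
Graphic {N} π = Σ (Graph N) λ G → Realizes G π

PotentiallyGraphic : ∀ {t N} → Graph t → Vec ℕ N → Set
PotentiallyGraphic {t} {N} H π = Σ (Graph N) λ G → Realizes G π × (H ⊆G G)

complementSeq : ∀ {N} → Vec ℕ N → Vec ℕ N
complementSeq {N} π = tabulate λ i → N ∸ 1 ∸ lookup π (opposite i)

PotRamseyProperty : ∀ {t₁ t₂} → Graph t₁ → Graph t₂ → ℕ → Set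
PotRamseyProperty H₁ H₂ N = (π : Vec ℕ N) → Nonincreasing π → Graphic π →
  PotentiallyGraphic H₁ π ⊎ PotentiallyGraphic H₂ (complementSeq π)

IsPotRamseyNumber : ∀ {t₁ t₂} → Graph t₁ → Graph t₂ → ℕ → Set
IsPotRamseyNumber H₁ H₂ r =
  PotRamseyProperty H₁ H₂ r × (∀ N → N Data.Nat.< r → ¬ PotRamseyProperty H₁ H₂ N)

-- For N ≤ t + s - 3 write N = a + b with a ≤ s - 2 and b ≤ t - 1.  The split graph
-- with a dominating clique of size a and b independent vertices has degree sequence
-- π = ((N-1)^a, a^b).  A copy of K_s in any realization of π needs s vertices of
-- degree ≥ s - 1 > a, yet only a entries of π are that large.  In the complementary
-- sequence ((b-1)^b, 0^a) only b entries are positive, while every vertex of H must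
-- land on a vertex of positive degree; so H, of order t > b, does not fit either.
module Submission where

open import Defs
open import Data.Nat using (ℕ; zero; suc; _+_; _∸_; _≤_; _<_; _⊓_; _⊔_; _<ᵇ_; z≤n; s≤s; >-nonZero)
open import Data.Nat.Properties hiding (_≟_)
open import Algebra.Properties.CommutativeSemigroup +-commutativeSemigroup using (x∙yz≈y∙xz)
open import Data.Bool using (Bool; true; false; if_then_else_; _∧_; _∨_)
open import Data.Bool.Properties using (∧-identityʳ; ∧-zeroʳ; ∨-comm)
open import Data.Fin using (Fin; zero; suc; toℕ; fromℕ<; punchIn; punchOut; opposite)
open import Data.Fin.Properties as Fin
  using (_≟_; punchInᵢ≢i; punchIn-punchOut; punchOut-injective; toℕ<n; toℕ-fromℕ<; toℕ-injective; injective⇒≤; opposite-prop)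
open import Data.Vec using (Vec; lookup; tabulate)
open import Data.Vec.Properties using (lookup∘tabulate)
open import Data.Product using (_,_; proj₁; proj₂)
open import Data.Sum using ([_,_]′)
open import Function using (_∘_)
open import Function.Definitions using (Injective)
open import Relation.Binary.PropositionalEquality as ≡
  using (_≡_; _≢_; refl; trans; cong; cong₂; subst; module ≡-Reasoning)
open import Relation.Nullary using (¬_; yes; no; contradiction)
open import Relation.Nullary.Reflects using (Reflects; ofʸ; ofⁿ)

count-cong : ∀ {n} {f g : Fin n → Bool} → (∀ i → f i ≡ g i) → count f ≡ count g
count-cong {zero}  f≗g = refl
count-cong {suc n} f≗g =
  cong₂ _+_ (cong (λ b → if b then 1 else 0) (f≗g zero)) (count-cong (f≗g ∘ suc))

count-true : ∀ {n} → count {n} (λ _ → true) ≡ n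
count-true {zero}  = refl
count-true {suc n} = cong suc count-true

count-false : ∀ {n} → count {n} (λ _ → false) ≡ 0
count-false {zero}  = refl
count-false {suc n} = count-false {n}

count-toℕ<ᵇ : ∀ {n} b → b ≤ n → count (λ (v : Fin n) → toℕ v <ᵇ b) ≡ b
count-toℕ<ᵇ {zero}  zero    _         = refl
count-toℕ<ᵇ {suc n} zero    _         = count-false {suc n}
count-toℕ<ᵇ {suc n} (suc b) (s≤s b≤n) = cong suc (count-toℕ<ᵇ b b≤n)

count-punchIn : ∀ {n} (f : Fin (suc n) → Bool) p →
                count f ≡ (if f p then 1 else 0) + count (f ∘ punchIn p)
count-punchIn         f zero    = refl
count-punchIn {suc n} f (suc p) = begin
  [ f zero ] + count (f ∘ suc)
    ≡⟨ cong ([ f zero ] +_) (count-punchIn (f ∘ suc) p) ⟩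
  [ f zero ] + ([ f (suc p) ] + count (f ∘ suc ∘ punchIn p))
    ≡⟨ x∙yz≈y∙xz [ f zero ] [ f (suc p) ] _ ⟩
  [ f (suc p) ] + ([ f zero ] + count (f ∘ suc ∘ punchIn p)) ∎
  where
  open ≡-Reasoning
  [_] : Bool → ℕ
  [ b ] = if b then 1 else 0

count-positive : ∀ {n} {f : Fin n → Bool} {i} → f i ≡ true → 1 ≤ count f
count-positive {suc n} {f} {i} fi≡true rewrite count-punchIn f i | fi≡true = s≤s z≤n

indicator-mono : ∀ {a b : Bool} → (a ≡ true → b ≡ true) →
                 (if a then 1 else 0) ≤ (if b then 1 else 0)
indicator-mono {false} _   = z≤n
indicator-mono {true}  a⇒b rewrite a⇒b refl = ≤-refl

-- Induct on the domain, deleting the image of zero from the codomain by punchIn.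
count-mono-injective : ∀ {m n} {P : Fin m → Bool} {Q : Fin n → Bool} (g : Fin m → Fin n) →
                       Injective _≡_ _≡_ g → (∀ i → P i ≡ true → Q (g i) ≡ true) →
                       count P ≤ count Q
count-mono-injective {zero}          g _ _ = z≤n
count-mono-injective {suc m} {zero}  g _ _ with g zero
... | ()
count-mono-injective {suc m} {suc n} {P} {Q} g g-inj P⇒Q = begin
  count P
    ≤⟨ +-mono-≤ (indicator-mono (P⇒Q zero)) tail-≤ ⟩
  (if Q (g zero) then 1 else 0) + count (Q ∘ punchIn (g zero))
    ≡⟨ count-punchIn Q (g zero) ⟨
  count Q ∎
  where
  open ≤-Reasoning
  g0≢g : ∀ j → g zero ≢ g (suc j)
  g0≢g j = Fin.0≢1+n ∘ g-inj
  tail-≤ : count (P ∘ suc) ≤ count (Q ∘ punchIn (g zero))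
  tail-≤ = count-mono-injective (λ j → punchOut (g0≢g j))
    (Fin.suc-injective ∘ g-inj ∘ punchOut-injective (g0≢g _) (g0≢g _))
    (λ j Pj → subst (λ v → Q v ≡ true) (≡.sym (punchIn-punchOut (g0≢g j))) (P⇒Q (suc j) Pj))

injective-below⇒≤ : ∀ {m n b} (g : Fin m → Fin n) → Injective _≡_ _≡_ g →
                    (∀ i → toℕ (g i) < b) → m ≤ b
injective-below⇒≤ g g-inj below = injective⇒≤ {f = λ i → fromℕ< (below i)} λ {i} {j} eq →
  g-inj (toℕ-injective (begin
    toℕ (g i)              ≡⟨ toℕ-fromℕ< (below i) ⟨
    toℕ (fromℕ< (below i)) ≡⟨ cong toℕ eq ⟩
    toℕ (fromℕ< (below j)) ≡⟨ toℕ-fromℕ< (below j) ⟩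
    toℕ (g j)              ∎))
  where open ≡-Reasoning

K-adj : ∀ {s} {u v : Fin s} → u ≢ v → adj (K s) u v ≡ true
K-adj {u = u} {v} u≢v with u ≟ v
... | yes u≡v = contradiction u≡v u≢v
... | no  _   = refl

degree-K : ∀ {s} (u : Fin s) → degree (K s) u ≡ s ∸ 1
degree-K {suc s} u rewrite count-punchIn (adj (K (suc s)) u) u | irrefl (K (suc s)) u =
  trans (count-cong (λ j → K-adj (punchInᵢ≢i u j ∘ ≡.sym))) count-true

⊆G⇒degree-≤ : ∀ {t n} {H : Graph t} {G : Graph n} (H⊆G : H ⊆G G) →
              ∀ u → degree H u ≤ degree G (proj₁ H⊆G u)
⊆G⇒degree-≤ (f , f-inj , f-hom) u = count-mono-injective f f-inj (f-hom u)

NoIsolated⇒degree-positive : ∀ {t} {H : Graph t} → NoIsolated H → ∀ v → 1 ≤ degree H v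
NoIsolated⇒degree-positive {H = H} noIsolated v = count-positive {f = adj H v} (proj₂ (noIsolated v))

potentiallyGraphic-order-≤ : ∀ {t N k b} (H : Graph t) (π : Vec ℕ N) →
                             PotentiallyGraphic H π → (∀ u → k ≤ degree H u) →
                             (∀ i → k ≤ lookup π i → toℕ i < b) → t ≤ b
potentiallyGraphic-order-≤ {k = k} H π (G , realizes , H⊆G@(f , f-inj , _)) k≤deg large⇒below =
  injective-below⇒≤ f f-inj λ u → large⇒below (f u) (begin
    k                 ≤⟨ k≤deg u ⟩
    degree H u        ≤⟨ ⊆G⇒degree-≤ {H = H} {G} H⊆G u ⟩
    degree G (f u)    ≡⟨ realizes (f u) ⟩
    lookup π (f u)    ∎)
  where open ≤-Reasoning

module SplitGraph (N a : ℕ) where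

  inClique : Fin N → Bool
  inClique i = toℕ i <ᵇ a

  inClique-reflects : ∀ i → Reflects (toℕ i < a) (inClique i)
  inClique-reflects i = <ᵇ-reflects-< (toℕ i) a

  graph : Graph N
  graph = record
    { adj    = λ u v → adj (K N) u v ∧ (inClique u ∨ inClique v)
    ; sym    = λ u v → cong₂ _∧_ (sym (K N) u v) (∨-comm (inClique u) (inClique v))
    ; irrefl = λ v → cong (_∧ (inClique v ∨ inClique v)) (irrefl (K N) v)
    }

  splitDegree : Fin N → ℕ
  splitDegree i = if inClique i then N ∸ 1 else a

  seq : Vec ℕ N
  seq = tabulate splitDegree

  degree-graph : a ≤ N → ∀ u → degree graph u ≡ splitDegree u
  degree-graph a≤N u with inClique u | inClique-reflects u
  ... | true  | _        = trans (count-cong {g = adj (K N) u} (λ v → ∧-identityʳ _)) (degree-K u)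
  ... | false | ofⁿ u∉A = trans (count-cong only-clique) (count-toℕ<ᵇ a a≤N)
    where
    only-clique : ∀ v → adj (K N) u v ∧ inClique v ≡ inClique v
    only-clique v with inClique v | inClique-reflects v
    ... | false | _        = ∧-zeroʳ _
    ... | true  | ofʸ v∈A = trans (∧-identityʳ _) (K-adj λ { refl → u∉A v∈A })

  graph-realizes : a ≤ N → Realizes graph seq
  graph-realizes a≤N u = trans (degree-graph a≤N u) (≡.sym (lookup∘tabulate _ u))

  seq-nonincreasing : Nonincreasing seq
  seq-nonincreasing i j i<j
    rewrite lookup∘tabulate splitDegree i | lookup∘tabulate splitDegree j
    with inClique i | inClique-reflects i | inClique j | inClique-reflects j
  ... | true  | _        | true  | _        = ≤-refl
  ... | false | _        | false | _        = ≤-refl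
  ... | true  | _        | false | ofⁿ j∉A = ≤-trans (≮⇒≥ j∉A) (vertex≤N∸1 j)
    where
    vertex≤N∸1 : ∀ {n} (k : Fin n) → toℕ k ≤ n ∸ 1
    vertex≤N∸1 {suc n} k = ≤-pred (toℕ<n k)
  ... | false | ofⁿ i∉A | true  | ofʸ j∈A = contradiction j∈A (<-asym (≤-<-trans (≮⇒≥ i∉A) i<j))

  seq-large⇒inClique : ∀ {k} → a < k → ∀ i → k ≤ lookup seq i → toℕ i < a
  seq-large⇒inClique a<k i k≤πᵢ rewrite lookup∘tabulate splitDegree i
    with inClique i | inClique-reflects i
  ... | true  | ofʸ i∈A = i∈A
  ... | false | _        = contradiction k≤πᵢ (<⇒≱ a<k)

  -- Index i of the complementary sequence refers to vertex opposite i of the split graph.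
  complementSeq-positive⇒below : ∀ i → 1 ≤ lookup (complementSeq seq) i → toℕ i < N ∸ a
  complementSeq-positive⇒below i 1≤π̅ᵢ
    rewrite lookup∘tabulate (λ i → N ∸ 1 ∸ lookup seq (opposite i)) i
          | lookup∘tabulate splitDegree (opposite i)
    with inClique (opposite i) | inClique-reflects (opposite i)
  ... | true  | _        = contradiction (≤-trans 1≤π̅ᵢ (≤-reflexive (n∸n≡0 (N ∸ 1)))) λ ()
  ... | false | ofⁿ ī∉A = m+n≤o⇒m≤o∸n (suc (toℕ i))
    (subst (_≤ N) (+-comm a _) (m≤o∸n⇒m+n≤o a (toℕ<n i)
      (subst (a ≤_) (opposite-prop i) (≮⇒≥ ī∉A))))

  seq-not-potentially-K : ∀ {s} → a < s ∸ 1 → ¬ PotentiallyGraphic (K s) seq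
  seq-not-potentially-K {s} a<s-1 Ks⊆ =
    <⇒≱ (<-≤-trans a<s-1 (m∸n≤m s 1))
        (potentiallyGraphic-order-≤ (K s) seq Ks⊆
          (≤-reflexive ∘ ≡.sym ∘ degree-K) (seq-large⇒inClique a<s-1))

  complementSeq-not-potentially : ∀ {t} (H : Graph t) → NoIsolated H → N ∸ a < t →
                                  ¬ PotentiallyGraphic H (complementSeq seq)
  complementSeq-not-potentially H noIsolated N-a<t H⊆ =
    <⇒≱ N-a<t (potentiallyGraphic-order-≤ H (complementSeq seq) H⊆
                (NoIsolated⇒degree-positive {H = H} noIsolated) complementSeq-positive⇒below)

  refutes : ∀ s {t} (H : Graph t) → a ≤ N → a < s ∸ 1 → N ∸ a < t → NoIsolated H →
            ¬ PotRamseyProperty (K s) H N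
  refutes s H a≤N a<s-1 N-a<t noIsolated P =
    [ seq-not-potentially-K a<s-1 , complementSeq-not-potentially H noIsolated N-a<t ]′
      (P seq seq-nonincreasing (graph , graph-realizes a≤N))

proposition3 : (s : ℕ) → 2 ≤ s → (t : ℕ) → 1 ≤ t → (H : Graph t) → NoIsolated H →
    (r : ℕ) → IsPotRamseyNumber (K s) H r → t + s ∸ 2 ≤ r
proposition3 s@(suc (suc s′)) 2≤s@(s≤s (s≤s _)) t 1≤t H noIsolated r (P , _) =
  subst (_≤ r) (≡.sym (+-∸-assoc t 2≤s)) (≮⇒≥ λ r<t+s′ →
    SplitGraph.refutes r (r ⊓ s′) s H
      (m⊓n≤m r s′) (m<n⇒o⊓m<n r ≤-refl) (r∸a<t r<t+s′) noIsolated P)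
  where
  r∸a<t : r < t + s′ → r ∸ (r ⊓ s′) < t
  r∸a<t r<t+s′ = begin-strict
    r ∸ (r ⊓ s′)        ≡⟨ ∸-distribˡ-⊓-⊔ r r s′ ⟩
    (r ∸ r) ⊔ (r ∸ s′)  ≡⟨ cong (_⊔ (r ∸ s′)) (n∸n≡0 r) ⟩
    r ∸ s′              <⟨ m<n+o⇒m∸n<o r s′ {{>-nonZero 1≤t}} (subst (r <_) (+-comm t s′) r<t+s′) ⟩
    t                   ∎
    where open ≤-Reasoning
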